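{- Let $k\ge 3$ and let $G$ be an $egr(n,k,g,\lambda)$ graph with $g$ even. For an even integer $\ell\le g+1$, let $c(\ell,k)$ denote the number of closed walks of length $\ell$ starting at a fixed vertex which do not contain cycles (the edges traversed form no cycle); this number is independent of the vertex and is a polynomial in $k$. Then: If $g\equiv 0 \pmod 4$, $$n(k,g,\lambda)\ge\frac{c(g,k)+k\lambda+k^{g}-2c(\tfrac{g}{2},k)k^{\frac{g}{2}}}{c(g,k)-c^2(\tfrac{g}{2},k)+k\lambda},\qquad n_2(k,g,\lambda)\ge2\,\frac{c(g,k)+k\lambda+k^{g}-2c(\tfrac{g}{2},k)k^{\frac{g}{2}}}{c(g,k)-c^2(\tfrac{g}{2},k)+k\lambda}.$$ If $g\equiv 2 \pmod 4$, $$n(k,g,\lambda)\ge\frac{c(g,k)+k\lambda+k^g}{c(g,k)+k\lambda},\qquad n_2(k,g,\lambda)\ge\frac{2k^g}{c(g,k)+k\lambda}.$$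
   Context: All graphs are finite and simple; throughout, $k>2$. A graph is an $egr(n,k,g,\lambda)$ (edge-girth-regular graph) if it is $k$-regular, has $n$ vertices, has girth $g$, and every edge lies in exactly $\lambda$ distinct cycles of length $g$. $n(k,g,\lambda)$ denotes the smallest order of any $egr(n,k,g,\lambda)$ graph, and $n_2(k,g,\lambda)$ the smallest order of a bipartite $egr(n,k,g,\lambda)$ graph. -}

module Defs where

open import Data.Nat using (ℕ; zero; suc; _+_; _*_; _∸_; _≤_; _<_)
open import Data.Bool using (Bool; true; false; _∧_; not; T; if_then_else_)
open import Data.Fin using (Fin)
open import Data.Fin.Properties using (_≟_)
open import Data.List using (List; []; _∷_; map; concatMap; allFin)
open import Data.Vec using (Vec; []; _∷_; last)
open import Data.Product using (Σ; _×_; ∃)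
open import Data.Empty using (⊥)
open import Relation.Binary.PropositionalEquality using (_≡_; _≢_)
open import Relation.Nullary.Decidable using (⌊_⌋)

record Graph (n : ℕ) : Set where
  field
    adj        : Fin n → Fin n → Bool
    adj-sym    : ∀ u v → adj u v ≡ adj v u
    adj-irrefl : ∀ v → adj v v ≡ false
open Graph public

countB : ∀ {A : Set} → (A → Bool) → List A → ℕ
countB p []       = 0
countB p (x ∷ xs) = (if p x then 1 else 0) + countB p xs

degree : ∀ {n} → Graph n → Fin n → ℕ
degree {n} G v = countB (adj G v) (allFin n)

allVecs : ∀ {n} m → List (Vec (Fin n) m)
allVecs zero          = [] ∷ []
allVecs {n} (suc m)   = concatMap (λ x → map (x ∷_) (allVecs m)) (allFin n)

module _ {n : ℕ} (G : Graph n) where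

  consecAdj : ∀ {m} → Vec (Fin n) m → Bool
  consecAdj []               = true
  consecAdj (x ∷ [])         = true
  consecAdj (x ∷ (y ∷ ws))   = adj G x y ∧ consecAdj (y ∷ ws)

  elemB : ∀ {m} → Fin n → Vec (Fin n) m → Bool
  elemB x []       = false
  elemB x (y ∷ ys) = if ⌊ x ≟ y ⌋ then true else elemB x ys

  distinctB : ∀ {m} → Vec (Fin n) m → Bool
  distinctB []       = true
  distinctB (x ∷ xs) = not (elemB x xs) ∧ distinctB xs

  closesB : ∀ {m} → Vec (Fin n) m → Bool
  closesB []       = false
  closesB (x ∷ xs) = adj G (last (x ∷ xs)) x

  -- w = (w₀,…,w_{m-1}) is the cyclic vertex sequence of a cycle
  -- w₀ w₁ … w_{m-1} w₀ (meaningful as a cycle for m ≥ 3)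
  isCycleSeq : ∀ {m} → Vec (Fin n) m → Bool
  isCycleSeq w = consecAdj w ∧ (distinctB w ∧ closesB w)

  HasCycleOfLength : ℕ → Set
  HasCycleOfLength m = 3 ≤ m × Σ (Vec (Fin n) m) (λ w → T (isCycleSeq w))

  HasGirth : ℕ → Set
  HasGirth g = HasCycleOfLength g × (∀ m → m < g → HasCycleOfLength m → ⊥)

  startsWith : ∀ {m} → Fin n → Fin n → Vec (Fin n) m → Bool
  startsWith u v (x ∷ (y ∷ _)) = ⌊ x ≟ u ⌋ ∧ ⌊ y ≟ v ⌋
  startsWith u v _             = false

  -- number of distinct cycles of length g containing the edge uv:
  -- each such cycle (as a subgraph) has exactly one cyclic vertex
  -- sequence of length g starting with u followed by v.
  cyclesThroughEdge : ℕ → Fin n → Fin n → ℕ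
  cyclesThroughEdge g u v =
    countB (λ w → startsWith u v w ∧ isCycleSeq w) (allVecs g)

  IsRegular : ℕ → Set
  IsRegular k = ∀ v → degree G v ≡ k

  IsBipartite : Set
  IsBipartite = Σ (Fin n → Bool) (λ col → ∀ u v → T (adj G u v) → col u ≢ col v)

record IsEGR {n : ℕ} (G : Graph n) (k g lam : ℕ) : Set where
  field
    regular    : IsRegular G k
    girth      : HasGirth G g
    edgeCycles : ∀ u v → T (adj G u v) → cyclesThroughEdge G g u v ≡ lam

-- treeWalks k ℓ d : number of walks of length ℓ in the infinite k-regular
-- tree from a vertex at distance d from the root, ending at the root.
treeWalks : ℕ → ℕ → ℕ → ℕ
treeWalks k zero    zero    = 1
treeWalks k zero    (suc d) = 0
treeWalks k (suc l) zero    = k * treeWalks k l 1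
treeWalks k (suc l) (suc d) = treeWalks k l d + (k ∸ 1) * treeWalks k l (suc (suc d))

-- c(ℓ,k): number of closed walks of length ℓ at a fixed vertex whose edges
-- contain no cycle; in a k-regular graph of girth g and ℓ ≤ g+1 these are
-- exactly the closed walks at the root of the k-regular tree.
c : ℕ → ℕ → ℕ
c l k = treeWalks k l 0

{-# OPTIONS --safe #-}
module Submission where

-- Fix m = g/2, a vertex x, and let W(v) be the number of walks of length m from x to v. By regularity
-- Σ_v W(v) = k^m, and Σ_v W(v)² is the number of closed walks of length g at x. Sorting the walks from x to u
-- of length l by their non-backtracking reduction gives walks_l(x,u) = Σ_d treeWalks(l,d)·nb_d(x,u); at u = x
-- girth g rules out closed non-backtracking walks of length 0 < d < g, and those of length g are g-cycles through
-- one of the k edges at x, at most kλ of them. Hence W(x) = c(m,k) and Σ_v W(v)² ≤ c(g,k) + kλ, and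
-- Cauchy–Schwarz over the M vertices v ≠ x where W can be non-zero gives
-- (k^m − c(m,k))² ≤ M·(c(g,k) + kλ − c(m,k)²), which rearranges to the bound with n = M + 1. In a bipartite
-- graph W vanishes off one colour class; adding the estimates at the two ends of an edge gives the factor 2.
-- If g ≡ 2 (mod 4) then m is odd and c(m,k) = 0.

import Algebra.Properties.CommutativeSemigroup as CommutativeSemigroup
open import Data.Bool using (Bool; true; false; _∧_; not; T; if_then_else_; _xor_)
import Data.Bool.Properties as Bool
open import Data.Bool.Properties using (T?; T-∧; T-≡; not-involutive; ¬-not; not-distribˡ-xor; not-distribʳ-xor)
open import Data.Empty using (⊥-elim)
open import Data.Fin using (Fin; zero; suc; toℕ)
open import Data.Fin.Properties using (_≟_; toℕ<n)
open import Data.List using (List; []; _∷_; map; concatMap; tabulate; _++_)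
open import Data.Nat hiding (_≟_)
open import Data.Nat.DivMod using (m/n*n≡m; [m+kn]%n≡m%n)
open import Data.Nat.Divisibility using (_∣_)
open import Data.Nat.Properties hiding (_≟_)
open import Data.Nat.Tactic.RingSolver using (solve-∀)
open import Data.Product using (Σ; ∃-syntax; _×_; _,_; proj₁; proj₂)
open import Data.Sum using (_⊎_; inj₁; inj₂; [_,_]′)
open import Data.Vec using (Vec; []; _∷_; last)
open import Function using (_∘_; case_of_)
open import Function.Bundles using (Equivalence)
open import Relation.Binary.PropositionalEquality
open import Relation.Nullary using (¬_; yes; no)
open import Relation.Nullary.Decidable using (⌊_⌋; does; dec-true; dec-false; isYes≗does)

open import Algebra.Properties.Semiring.Sum +-*-semiring
  using (sum; sum-syntax; ∑-distrib-+; ∑-comm; *-distribˡ-sum; *-distribʳ-sum; sum-cong-≗; sum-replicate-zero)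

open import Defs

*-left-comm : ∀ a b c → a * (b * c) ≡ b * (a * c)
*-left-comm = CommutativeSemigroup.x∙yz≈y∙xz *-commutativeSemigroup

+-left-comm : ∀ a b c → a + (b + c) ≡ b + (a + c)
+-left-comm = CommutativeSemigroup.x∙yz≈y∙xz +-commutativeSemigroup

𝟙 : Bool → ℕ
𝟙 b = if b then 1 else 0

-- δ uses does rather than ⌊_⌋, which is strict: only then does δ (suc i) (suc j) reduce to δ i j.
δ : ∀ {n} → Fin n → Fin n → ℕ
δ i j = 𝟙 (does (i ≟ j))

δ-sym : ∀ {n} (i j : Fin n) → δ i j ≡ δ j i
δ-sym zero    zero    = refl
δ-sym zero    (suc j) = refl
δ-sym (suc i) zero    = refl
δ-sym (suc i) (suc j) = δ-sym i j

δ-refl : ∀ {n} (i : Fin n) → δ i i ≡ 1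
δ-refl i = cong 𝟙 (dec-true (i ≟ i) refl)

δ-≢ : ∀ {n} {i j : Fin n} → i ≢ j → δ i j ≡ 0
δ-≢ {i = i} {j} i≢j = cong 𝟙 (dec-false (i ≟ j) i≢j)

𝟙-idem : ∀ b → 𝟙 b * 𝟙 b ≡ 𝟙 b
𝟙-idem true  = refl
𝟙-idem false = refl

𝟙-∧ : ∀ a b → 𝟙 (a ∧ b) ≡ 𝟙 a * 𝟙 b
𝟙-∧ true  b = sym (+-identityʳ (𝟙 b))
𝟙-∧ false b = refl

𝟙-not+𝟙 : ∀ b → 𝟙 (not b) + 𝟙 b ≡ 1
𝟙-not+𝟙 true  = refl
𝟙-not+𝟙 false = refl

𝟙-guard : ∀ b {m} → (T b → m ≡ 0) → 𝟙 b * m ≡ 0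
𝟙-guard true  m≡0 = trans (+-identityʳ _) (m≡0 _)
𝟙-guard false m≡0 = refl

𝟙-guard-≤ : ∀ b {m o} → (T b → m ≤ o) → 𝟙 b * m ≤ 𝟙 b * o
𝟙-guard-≤ true  m≤o = +-monoˡ-≤ 0 (m≤o _)
𝟙-guard-≤ false m≤o = z≤n

¬T⇒T-not : ∀ {a} → ¬ T a → T (not a)
¬T⇒T-not {true}  ¬a = ¬a _
¬T⇒T-not {false} _  = _

T-not⇒¬T : ∀ {a} → T (not a) → ¬ T a
T-not⇒¬T {true} () _

¬T-not⇒T : ∀ {a} → ¬ T (not a) → T a
¬T-not⇒T {true}  _  = _
¬T-not⇒T {false} ¬t = ¬t _

sum-zero : ∀ {n} {f : Fin n → ℕ} → (∀ i → f i ≡ 0) → sum f ≡ 0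
sum-zero {n} f≡0 = trans (sum-cong-≗ f≡0) (sum-replicate-zero n)

sum-mono-≤ : ∀ {n} {f h : Fin n → ℕ} → (∀ i → f i ≤ h i) → sum f ≤ sum h
sum-mono-≤ {zero}  f≤h = z≤n
sum-mono-≤ {suc n} f≤h = +-mono-≤ (f≤h zero) (sum-mono-≤ (f≤h ∘ suc))

sum-ones : ∀ n → ∑[ i < n ] 1 ≡ n
sum-ones zero    = refl
sum-ones (suc n) = cong suc (sum-ones n)

sum-δ : ∀ {n} (j : Fin n) (f : Fin n → ℕ) → ∑[ i < n ] (δ i j * f i) ≡ f j
sum-δ {suc n} zero    f = trans (cong₂ _+_ (+-identityʳ (f zero)) (sum-replicate-zero n)) (+-identityʳ (f zero))
sum-δ {suc n} (suc j) f = sum-δ j (f ∘ suc)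

sum-δˡ : ∀ {n} (j : Fin n) (f : Fin n → ℕ) → ∑[ i < n ] (δ j i * f i) ≡ f j
sum-δˡ j f = trans (sum-cong-≗ (λ i → cong (_* f i) (δ-sym j i))) (sum-δ j f)

sum-δʳ : ∀ {n} (j : Fin n) (f : Fin n → ℕ) → ∑[ i < n ] (f i * δ i j) ≡ f j
sum-δʳ j f = trans (sum-cong-≗ (λ i → *-comm (f i) (δ i j))) (sum-δ j f)

sum-*-sum : ∀ {n} (f h : Fin n → ℕ) → sum f * sum h ≡ ∑[ i < n ] ∑[ j < n ] (f i * h j)
sum-*-sum f h = trans (*-distribʳ-sum (sum h) f) (sum-cong-≗ (λ i → *-distribˡ-sum (f i) h))

sum-split-support : ∀ {n} (S : Fin n → Bool) (f : Fin n → ℕ) (x : Fin n) → S x ≡ false →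
                    (∀ v → v ≢ x → ¬ T (S v) → f v ≡ 0) → f x + ∑[ v < n ] (𝟙 (S v) * f v) ≡ sum f
sum-split-support {n} S f x Sx≡false support = begin
  f x + ∑[ v < n ] (𝟙 (S v) * f v)
    ≡⟨ cong (_+ ∑[ v < n ] (𝟙 (S v) * f v)) (sum-δ x f) ⟨
  ∑[ v < n ] (δ v x * f v) + ∑[ v < n ] (𝟙 (S v) * f v)
    ≡⟨ ∑-distrib-+ (λ v → δ v x * f v) (λ v → 𝟙 (S v) * f v) ⟨
  ∑[ v < n ] (δ v x * f v + 𝟙 (S v) * f v)
    ≡⟨ sum-cong-≗ pointwise ⟩
  sum f ∎
  where
  open ≡-Reasoning
  pointwise : ∀ v → δ v x * f v + 𝟙 (S v) * f v ≡ f v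
  pointwise v with S v in Sv
  ... | true  = trans (cong (λ t → t * f v + (f v + 0)) (δ-≢ v≢x)) (+-identityʳ (f v))
    where
    v≢x : v ≢ x
    v≢x refl = case trans (sym Sv) Sx≡false of λ ()
  ... | false with v ≟ x
  ...   | yes refl = trans (+-identityʳ _) (*-identityˡ (f v))
  ...   | no  v≢x  = sym (support v v≢x (λ Sv-true → subst T Sv Sv-true))

sum-vanishing-tail : ∀ {B C} (f : ℕ → ℕ) → B ≤ C → (∀ d → B ≤ d → f d ≡ 0) →
                     ∑[ d < C ] f (toℕ d) ≡ ∑[ d < B ] f (toℕ d)
sum-vanishing-tail {zero} {C}      f _         vanish = sum-zero {C} (λ d → vanish (toℕ d) z≤n)
sum-vanishing-tail {suc B} {suc C} f (s≤s B≤C) vanish =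
  cong (f 0 +_) (sum-vanishing-tail (f ∘ suc) B≤C (λ d B≤d → vanish (suc d) (s≤s B≤d)))

sum-only-last : ∀ {B} (f : ℕ → ℕ) → (∀ d → d < B → f d ≡ 0) → ∑[ d < suc B ] f (toℕ d) ≡ f B
sum-only-last {zero}  f vanish = +-identityʳ (f 0)
sum-only-last {suc B} f vanish =
  trans (cong (_+ ∑[ d < suc B ] f (suc (toℕ d))) (vanish 0 z<s))
        (sum-only-last (f ∘ suc) (λ d d<B → vanish (suc d) (s<s d<B)))

countB-tabulate : ∀ {A : Set} {n} (p : A → Bool) (f : Fin n → A) → countB p (tabulate f) ≡ ∑[ i < n ] 𝟙 (p (f i))
countB-tabulate {n = zero}  p f = refl
countB-tabulate {n = suc n} p f = cong (𝟙 (p (f zero)) +_) (countB-tabulate p (f ∘ suc))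

countB-++ : ∀ {A : Set} (p : A → Bool) (xs ys : List A) → countB p (xs ++ ys) ≡ countB p xs + countB p ys
countB-++ p []       ys = refl
countB-++ p (x ∷ xs) ys = trans (cong (𝟙 (p x) +_) (countB-++ p xs ys)) (sym (+-assoc (𝟙 (p x)) _ _))

countB-map : ∀ {A B : Set} (p : B → Bool) (f : A → B) (xs : List A) → countB p (map f xs) ≡ countB (p ∘ f) xs
countB-map p f []       = refl
countB-map p f (x ∷ xs) = cong (𝟙 (p (f x)) +_) (countB-map p f xs)

countB-∧ : ∀ {A : Set} b (q : A → Bool) (xs : List A) → countB (λ x → b ∧ q x) xs ≡ 𝟙 b * countB q xs
countB-∧ true  q xs       = sym (+-identityʳ (countB q xs))
countB-∧ false q []       = refl
countB-∧ false q (x ∷ xs) = countB-∧ false q xs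

countB-mono : ∀ {A : Set} {p q : A → Bool} (xs : List A) → (∀ x → T (p x) → T (q x)) → countB p xs ≤ countB q xs
countB-mono [] p⇒q = z≤n
countB-mono {p = p} {q} (x ∷ xs) p⇒q with p x | q x | p⇒q x
... | true  | true  | _    = s≤s (countB-mono xs p⇒q)
... | true  | false | p⇒qx = ⊥-elim (p⇒qx _)
... | false | _     | _    = ≤-trans (countB-mono xs p⇒q) (m≤n+m _ _)

countB-none : ∀ {A : Set} {p : A → Bool} (xs : List A) → (∀ x → ¬ T (p x)) → countB p xs ≡ 0
countB-none []                 ¬p = refl
countB-none {p = p} (x ∷ xs) ¬p with p x | ¬p x
... | true  | ¬px = ⊥-elim (¬px _)
... | false | _   = countB-none xs ¬p

countB-concatMap-tabulate : ∀ {A B : Set} {n} (p : B → Bool) (f : A → List B) (h : Fin n → A) →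
  countB p (concatMap f (tabulate h)) ≡ ∑[ i < n ] countB p (f (h i))
countB-concatMap-tabulate {n = zero}  p f h = refl
countB-concatMap-tabulate {n = suc n} p f h =
  trans (countB-++ p (f (h zero)) _) (cong (countB p (f (h zero)) +_) (countB-concatMap-tabulate p f (h ∘ suc)))

countB-allVecs : ∀ {n} m (p : Vec (Fin n) (suc m) → Bool) →
  countB p (allVecs (suc m)) ≡ ∑[ x < n ] countB (p ∘ (x ∷_)) (allVecs m)
countB-allVecs m p = trans (countB-concatMap-tabulate p (λ x → map (x ∷_) (allVecs m)) (λ x → x))
                           (sum-cong-≗ (λ x → countB-map p (x ∷_) (allVecs m)))

2*m*n≤m*m+n*n : ∀ m n → 2 * (m * n) ≤ m * m + n * n
2*m*n≤m*m+n*n m n =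
  [ ordered , (λ n≤m → subst₂ _≤_ (cong (2 *_) (*-comm n m)) (+-comm (n * n) (m * m)) (ordered n≤m)) ]′ (≤-total m n)
  where
  ordered : ∀ {a b} → a ≤ b → 2 * (a * b) ≤ a * a + b * b
  ordered {a} {b} a≤b = subst (λ b → 2 * (a * b) ≤ a * a + b * b) (m+[n∸m]≡n a≤b)
                          (subst (2 * (a * (a + (b ∸ a))) ≤_) (expand a (b ∸ a)) (m≤m+n _ _))
    where
    expand : ∀ a t → 2 * (a * (a + t)) + t * t ≡ a * a + (a + t) * (a + t)
    expand = solve-∀

cauchy-schwarz : ∀ {n} (a x : Fin n → ℕ) →
  (∑[ i < n ] (a i * x i)) * (∑[ i < n ] (a i * x i)) ≤ sum a * ∑[ i < n ] (a i * (x i * x i))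
cauchy-schwarz {n} a x = *-cancelˡ-≤ 2 (begin
  2 * (sum ax * sum ax)                                      ≡⟨ cong (2 *_) (sum-*-sum ax ax) ⟩
  2 * ∑[ i < n ] ∑[ j < n ] (ax i * ax j)                     ≡⟨ double-sum-*ˡ 2 (λ i j → ax i * ax j) ⟩
  ∑[ i < n ] ∑[ j < n ] (2 * (ax i * ax j))                   ≤⟨ sum-mono-≤ (λ i → sum-mono-≤ (λ j → cross i j)) ⟩
  ∑[ i < n ] ∑[ j < n ] (a i * axx j + axx i * a j)           ≡⟨ double-sum-distrib-+ (λ i j → a i * axx j) (λ i j → axx i * a j) ⟩
  ∑[ i < n ] ∑[ j < n ] (a i * axx j) + ∑[ i < n ] ∑[ j < n ] (axx i * a j)
                                                              ≡⟨ cong₂ _+_ (sum-*-sum a axx) (sum-*-sum axx a) ⟨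
  sum a * sum axx + sum axx * sum a                           ≡⟨ cong (sum a * sum axx +_) (*-comm (sum axx) (sum a)) ⟩
  sum a * sum axx + sum a * sum axx                           ≡⟨ cong (sum a * sum axx +_) (+-identityʳ _) ⟨
  2 * (sum a * sum axx)                                       ∎)
  where
  open ≤-Reasoning
  ax axx : Fin n → ℕ
  ax i = a i * x i
  axx i = a i * (x i * x i)
  double-sum-*ˡ : ∀ c (f : Fin n → Fin n → ℕ) → c * ∑[ i < n ] ∑[ j < n ] f i j ≡ ∑[ i < n ] ∑[ j < n ] (c * f i j)
  double-sum-*ˡ c f = trans (*-distribˡ-sum c (λ i → ∑[ j < n ] f i j)) (sum-cong-≗ (λ i → *-distribˡ-sum c (f i)))
  double-sum-distrib-+ : ∀ (f h : Fin n → Fin n → ℕ) →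
    ∑[ i < n ] ∑[ j < n ] (f i j + h i j) ≡ ∑[ i < n ] ∑[ j < n ] f i j + ∑[ i < n ] ∑[ j < n ] h i j
  double-sum-distrib-+ f h =
    trans (sum-cong-≗ (λ i → ∑-distrib-+ (f i) (h i))) (∑-distrib-+ (λ i → ∑[ j < n ] f i j) (λ i → ∑[ j < n ] h i j))
  cross : ∀ i j → 2 * (ax i * ax j) ≤ a i * axx j + axx i * a j
  cross i j = subst₂ _≤_ (lhs (a i) (a j) (x i) (x j)) (rhs (a i) (a j) (x i) (x j))
                         (*-monoʳ-≤ (a i * a j) (2*m*n≤m*m+n*n (x i) (x j)))
    where
    lhs : ∀ p q s t → p * q * (2 * (s * t)) ≡ 2 * (p * s * (q * t))
    lhs = solve-∀
    rhs : ∀ p q s t → p * q * (s * s + t * t) ≡ p * (q * (t * t)) + p * (s * s) * q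
    rhs = solve-∀

-- Walks

odd : ℕ → Bool
odd zero    = false
odd (suc l) = not (odd l)

module Walks {n : ℕ} (G : Graph n) where

  A : Fin n → Fin n → ℕ
  A x y = 𝟙 (adj G x y)

  A-sym : ∀ x y → A x y ≡ A y x
  A-sym x y = cong 𝟙 (adj-sym G x y)

  walks : ℕ → Fin n → Fin n → ℕ
  walks zero    x y = δ x y
  walks (suc l) x y = ∑[ z < n ] (A x z * walks l z y)

  Supported : ℕ → Fin n → (Fin n → Bool) → Set
  Supported m x S = S x ≡ false × (∀ v → v ≢ x → ¬ T (S v) → walks m x v ≡ 0)

  walks-1 : ∀ x y → walks 1 x y ≡ A x y
  walks-1 x y = sum-δʳ y (A x)

  walks-+ : ∀ a b x y → walks (a + b) x y ≡ ∑[ z < n ] (walks a x z * walks b z y)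
  walks-+ zero    b x y = sym (sum-δˡ x (λ z → walks b z y))
  walks-+ (suc a) b x y = begin
    ∑[ w < n ] (A x w * walks (a + b) w y)
      ≡⟨ sum-cong-≗ (λ w → cong (A x w *_) (walks-+ a b w y)) ⟩
    ∑[ w < n ] (A x w * ∑[ z < n ] (walks a w z * walks b z y))
      ≡⟨ sum-cong-≗ (λ w → *-distribˡ-sum (A x w) (λ z → walks a w z * walks b z y)) ⟩
    ∑[ w < n ] ∑[ z < n ] (A x w * (walks a w z * walks b z y))
      ≡⟨ ∑-comm (λ w z → A x w * (walks a w z * walks b z y)) ⟩
    ∑[ z < n ] ∑[ w < n ] (A x w * (walks a w z * walks b z y))
      ≡⟨ sum-cong-≗ (λ z → sum-cong-≗ (λ w → *-assoc (A x w) (walks a w z) (walks b z y))) ⟨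
    ∑[ z < n ] ∑[ w < n ] (A x w * walks a w z * walks b z y)
      ≡⟨ sum-cong-≗ (λ z → *-distribʳ-sum (walks b z y) (λ w → A x w * walks a w z)) ⟨
    ∑[ z < n ] (walks (suc a) x z * walks b z y) ∎
    where open ≡-Reasoning

  walks-sym : ∀ l x y → walks l x y ≡ walks l y x
  walks-sym zero    x y = δ-sym x y
  walks-sym (suc l) x y = begin
    walks (suc l) x y                      ≡⟨ cong (λ m → walks m x y) (+-comm 1 l) ⟩
    walks (l + 1) x y                      ≡⟨ walks-+ l 1 x y ⟩
    ∑[ z < n ] (walks l x z * walks 1 z y) ≡⟨ sum-cong-≗ (λ z → cong₂ _*_ (walks-sym l x z)
                                                                         (trans (walks-1 z y) (A-sym z y))) ⟩
    ∑[ z < n ] (walks l z x * A y z)       ≡⟨ sum-cong-≗ (λ z → *-comm (walks l z x) (A y z)) ⟩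
    walks (suc l) y x                      ∎
    where open ≡-Reasoning

  sum-walks² : ∀ m x → ∑[ y < n ] (walks m x y * walks m x y) ≡ walks (m + m) x x
  sum-walks² m x = trans (sum-cong-≗ (λ y → cong (walks m x y *_) (walks-sym m x y))) (sym (walks-+ m m x x))

  module _ {k : ℕ} (regular : IsRegular G k) where

    sum-A : ∀ x → sum (A x) ≡ k
    sum-A x = trans (sym (countB-tabulate (adj G x) (λ y → y))) (regular x)

    sum-walks : ∀ l x → ∑[ y < n ] walks l x y ≡ k ^ l
    sum-walks zero    x = trans (sum-cong-≗ (λ y → sym (*-identityʳ (δ x y)))) (sum-δˡ x (λ _ → 1))
    sum-walks (suc l) x = begin
      ∑[ y < n ] ∑[ z < n ] (A x z * walks l z y) ≡⟨ ∑-comm (λ y z → A x z * walks l z y) ⟩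
      ∑[ z < n ] ∑[ y < n ] (A x z * walks l z y) ≡⟨ sum-cong-≗ (λ z → *-distribˡ-sum (A x z) (walks l z)) ⟨
      ∑[ z < n ] (A x z * ∑[ y < n ] walks l z y) ≡⟨ sum-cong-≗ (λ z → cong (A x z *_) (sum-walks l z)) ⟩
      ∑[ z < n ] (A x z * k ^ l)                  ≡⟨ *-distribʳ-sum (k ^ l) (A x) ⟨
      sum (A x) * k ^ l                           ≡⟨ cong (_* k ^ l) (sum-A x) ⟩
      k * k ^ l                                   ∎
      where open ≡-Reasoning

  walks-bipartite : (col : Fin n → Bool) → (∀ x y → T (adj G x y) → col x ≢ col y) →
                    ∀ l x y → col y ≢ odd l xor col x → walks l x y ≡ 0
  walks-bipartite col proper zero    x y y≢x = δ-≢ (λ x≡y → y≢x (cong col (sym x≡y)))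
  walks-bipartite col proper (suc l) x y y≢ = sum-zero (λ z → 𝟙-guard (adj G x z) (λ xz →
    walks-bipartite col proper l z y (λ y≡ → y≢ (trans y≡ (flip (col x) (col z) (proper x z xz))))))
    where
    flip : ∀ a b → a ≢ b → odd l xor b ≡ not (odd l) xor a
    flip a b a≢b = begin
      odd l xor b       ≡⟨ cong (odd l xor_) (¬-not (λ b≡a → a≢b (sym b≡a))) ⟩
      odd l xor not a   ≡⟨ not-distribʳ-xor (odd l) a ⟨
      not (odd l xor a) ≡⟨ not-distribˡ-xor (odd l) a ⟩
      not (odd l) xor a ∎
      where open ≡-Reasoning

-- Walks in the k-regular tree

module _ (k : ℕ) where

  treeWalks-beyond : ∀ {l d} → l < d → treeWalks k l d ≡ 0
  treeWalks-beyond {zero}  {suc d} _         = refl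
  treeWalks-beyond {suc l} {suc d} (s≤s l<d) = trans
    (cong₂ (λ a b → a + (k ∸ 1) * b) (treeWalks-beyond l<d) (treeWalks-beyond (m<n⇒m<1+n (m<n⇒m<1+n l<d))))
    (*-zeroʳ (k ∸ 1))

  treeWalks-diag : ∀ l → treeWalks k l l ≡ 1
  treeWalks-diag zero    = refl
  treeWalks-diag (suc l) = trans
    (cong₂ (λ a b → a + (k ∸ 1) * b) (treeWalks-diag l) (treeWalks-beyond (m<n⇒m<1+n (n<1+n l))))
    (cong suc (*-zeroʳ (k ∸ 1)))

  treeWalks-parity : ∀ l d → odd l ≢ odd d → treeWalks k l d ≡ 0
  treeWalks-parity zero    zero    l≢d = ⊥-elim (l≢d refl)
  treeWalks-parity zero    (suc d) l≢d = refl
  treeWalks-parity (suc l) zero    l≢d = trans (cong (k *_) (treeWalks-parity l 1 (l≢d ∘ cong not))) (*-zeroʳ k)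
  treeWalks-parity (suc l) (suc d) l≢d = trans
    (cong₂ (λ a b → a + (k ∸ 1) * b) (treeWalks-parity l d (l≢d ∘ cong not))
           (treeWalks-parity l (2 + d) (λ l≡ → l≢d (cong not (trans l≡ (not-involutive (odd d)))))))
    (*-zeroʳ (k ∸ 1))

c-odd : ∀ k m → odd m ≡ true → c m k ≡ 0
c-odd k m odd-m = treeWalks-parity k m 0 (λ m-even → case trans (sym odd-m) m-even of λ ())

-- Non-backtracking walks and cycles

module CycleExtraction {n : ℕ} (G : Graph n) where

  nonBacktracking : ∀ {m} → Vec (Fin n) m → Bool
  nonBacktracking (a ∷ b ∷ c ∷ w) = not (does (c ≟ a)) ∧ nonBacktracking (b ∷ c ∷ w)
  nonBacktracking _               = true

  record _⊆_ {i j} (xs : Vec (Fin n) i) (ys : Vec (Fin n) j) : Set where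
    constructor sub
    field ∈-⊆ : ∀ t → T (elemB G t xs) → T (elemB G t ys)
  open _⊆_

  ∉-⊆ : ∀ {i j} {xs : Vec (Fin n) i} {ys : Vec (Fin n) j} t → xs ⊆ ys → T (not (elemB G t ys)) → T (not (elemB G t xs))
  ∉-⊆ t xs⊆ys t∉ys = ¬T⇒T-not (T-not⇒¬T t∉ys ∘ ∈-⊆ xs⊆ys t)

  ∉-∷ : ∀ {i} {xs : Vec (Fin n) i} t y → t ≢ y → T (not (elemB G t xs)) → T (not (elemB G t (y ∷ xs)))
  ∉-∷ t y t≢y t∉xs with t ≟ y
  ... | yes t≡y = ⊥-elim (t≢y t≡y)
  ... | no  _   = t∉xs

  ∷-⊆-∷ : ∀ {i j} {xs : Vec (Fin n) i} {ys : Vec (Fin n) j} y → xs ⊆ ys → (y ∷ xs) ⊆ (y ∷ ys)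
  ∈-⊆ (∷-⊆-∷ y xs⊆ys) t t∈ with t ≟ y
  ... | yes _ = _
  ... | no  _ = ∈-⊆ xs⊆ys t t∈

  walk-∷⁻ : ∀ {m} x y (w : Vec (Fin n) m) → T (consecAdj G (x ∷ y ∷ w)) → T (adj G x y) × T (consecAdj G (y ∷ w))
  walk-∷⁻ x y w = Equivalence.to (T-∧ {adj G x y} {consecAdj G (y ∷ w)})

  walk-∷⁺ : ∀ {m} x y (w : Vec (Fin n) m) → T (adj G x y) → T (consecAdj G (y ∷ w)) → T (consecAdj G (x ∷ y ∷ w))
  walk-∷⁺ x y w xy yw = Equivalence.from (T-∧ {adj G x y} {consecAdj G (y ∷ w)}) (xy , yw)

  distinct-∷⁻ : ∀ {m} x (w : Vec (Fin n) m) → T (distinctB G (x ∷ w)) → T (not (elemB G x w)) × T (distinctB G w)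
  distinct-∷⁻ x w = Equivalence.to (T-∧ {not (elemB G x w)} {distinctB G w})

  distinct-∷⁺ : ∀ {m} x (w : Vec (Fin n) m) → T (not (elemB G x w)) → T (distinctB G w) → T (distinctB G (x ∷ w))
  distinct-∷⁺ x w x∉w dw = Equivalence.from (T-∧ {not (elemB G x w)} {distinctB G w}) (x∉w , dw)

  -- pre is the part of ys before x.
  firstVisit : ∀ x a {m} (ys : Vec (Fin n) m) → T (consecAdj G (a ∷ ys)) → T (distinctB G ys) → T (elemB G x ys) →
    ∃[ j ] j < m × Σ (Vec (Fin n) j) λ pre →
      T (consecAdj G (a ∷ pre)) × T (adj G (last (a ∷ pre)) x) × T (distinctB G pre) × T (not (elemB G x pre)) × pre ⊆ ys
  firstVisit x a (y ∷ ys) walk distinct x∈ with x ≟ y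
  ... | yes refl = 0 , z<s , [] , _ , proj₁ (walk-∷⁻ a y ys walk) , _ , _ , sub (λ _ ())
  ... | no  x≢y with firstVisit x y ys (proj₂ (walk-∷⁻ a y ys walk)) (proj₂ (distinct-∷⁻ y ys distinct)) x∈
  ...   | j , j<m , pre , walk′ , closes , distinct′ , x∉pre , pre⊆ys =
    suc j , s<s j<m , y ∷ pre , walk-∷⁺ a y pre (proj₁ (walk-∷⁻ a y ys walk)) walk′ , closes ,
    distinct-∷⁺ y pre (∉-⊆ y pre⊆ys (proj₁ (distinct-∷⁻ y ys distinct))) distinct′ , ∉-∷ {xs = pre} x y x≢y x∉pre ,
    ∷-⊆-∷ y pre⊆ys

  consecAdj-tail : ∀ {m} x (w : Vec (Fin n) m) → T (consecAdj G (x ∷ w)) → T (consecAdj G w)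
  consecAdj-tail x []      _    = _
  consecAdj-tail x (y ∷ w) walk = proj₂ (walk-∷⁻ x y w walk)

  nonBacktracking-tail : ∀ {m} x (w : Vec (Fin n) m) → T (nonBacktracking (x ∷ w)) → T (nonBacktracking w)
  nonBacktracking-tail x []          _   = _
  nonBacktracking-tail x (y ∷ [])    _   = _
  nonBacktracking-tail x (y ∷ z ∷ w) nbt = proj₂ (Equivalence.to (T-∧ {not (does (z ≟ x))}) nbt)

  cycle-from-return : ∀ x y z {m} (w : Vec (Fin n) m) →
    T (consecAdj G (x ∷ y ∷ z ∷ w)) → T (distinctB G (y ∷ z ∷ w)) → x ≢ y → x ≢ z → T (elemB G x w) →
    ∃[ j ] (j < 3 + m × HasCycleOfLength G j)
  cycle-from-return x y z w walk distinct x≢y x≢z x∈w with walk-∷⁻ x y (z ∷ w) walk | distinct-∷⁻ y (z ∷ w) distinct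
  ... | xy , walk-yz | y∉zw , distinct-zw with walk-∷⁻ y z w walk-yz | distinct-∷⁻ z w distinct-zw
  ... | yz , walk-z | z∉w , distinct-w with firstVisit x z w walk-z distinct-w x∈w
  ... | j , j<m , pre , walk-zpre , closes , distinct-pre , x∉pre , pre⊆w =
    3 + j , s<s (s<s (s<s j<m)) , s≤s (s≤s (s≤s z≤n)) , x ∷ y ∷ z ∷ pre ,
    Equivalence.from T-∧ (walk-∷⁺ x y (z ∷ pre) xy (walk-∷⁺ y z pre yz walk-zpre) ,
                          Equivalence.from T-∧ (distinct-∷⁺ x (y ∷ z ∷ pre) x∉ (distinct-∷⁺ y (z ∷ pre) y∉
                                                (distinct-∷⁺ z pre (∉-⊆ z pre⊆w z∉w) distinct-pre)) , closes))
    where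
    x∉ : T (not (elemB G x (y ∷ z ∷ pre)))
    x∉ = ∉-∷ {xs = z ∷ pre} x y x≢y (∉-∷ {xs = pre} x z x≢z x∉pre)
    y∉ : T (not (elemB G y (z ∷ pre)))
    y∉ = ∉-⊆ y (∷-⊆-∷ z pre⊆w) y∉zw

  repeated-start⇒shorterCycle : ∀ x {m} (w : Vec (Fin n) m) → T (consecAdj G (x ∷ w)) → T (nonBacktracking (x ∷ w)) →
            T (distinctB G w) → T (elemB G x w) → ∃[ j ] (j < suc m × HasCycleOfLength G j)
  repeated-start⇒shorterCycle x (y ∷ w) walk nbt distinct x∈ with x ≟ y
  repeated-start⇒shorterCycle x (y ∷ w)     walk nbt distinct x∈ | yes refl =
    ⊥-elim (subst T (adj-irrefl G x) (proj₁ (walk-∷⁻ x x w walk)))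
  repeated-start⇒shorterCycle x (y ∷ [])    walk nbt distinct () | no x≢y
  repeated-start⇒shorterCycle x (y ∷ z ∷ w) walk nbt distinct x∈ | no x≢y with x ≟ z
  ... | yes refl = ⊥-elim (T-not⇒¬T (proj₁ (Equivalence.to (T-∧ {not (does (x ≟ x))}) nbt))
                                  (subst T (sym (dec-true (x ≟ x) refl)) _))
  ... | no  x≢z  = cycle-from-return x y z w walk distinct x≢y x≢z x∈

  distinct-or-shorterCycle : ∀ {m} (w : Vec (Fin n) m) → T (consecAdj G w) → T (nonBacktracking w) →
                             T (distinctB G w) ⊎ ∃[ j ] (j < m × HasCycleOfLength G j)
  distinct-or-shorterCycle []      _    _   = inj₁ _
  distinct-or-shorterCycle (x ∷ w) walk nbt
    with distinct-or-shorterCycle w (consecAdj-tail x w walk) (nonBacktracking-tail x w nbt)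
  ... | inj₂ (j , j<m , cycle) = inj₂ (j , m<n⇒m<1+n j<m , cycle)
  ... | inj₁ distinct with T? (elemB G x w)
  ...   | no  x∉w = inj₁ (distinct-∷⁺ x w (¬T⇒T-not x∉w) distinct)
  ...   | yes x∈w = inj₂ (repeated-start⇒shorterCycle x w walk nbt distinct x∈w)

cycle⇒edge : ∀ {n} (G : Graph n) {l} → HasCycleOfLength G l → ∃[ u ] ∃[ w ] T (adj G u w)
cycle⇒edge G (s≤s (s≤s (s≤s _)) , u ∷ w ∷ rest , cycle) =
  u , w , proj₁ (CycleExtraction.walk-∷⁻ G u w rest (proj₁ (Equivalence.to (T-∧ {consecAdj G (u ∷ w ∷ rest)}) cycle)))

module NonBacktracking {n : ℕ} (G : Graph n) {k : ℕ} (regular : IsRegular G k) (u : Fin n) where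
  open Walks G
  open CycleExtraction G using (nonBacktracking; walk-∷⁺)

  A∖ : Fin n → Fin n → Fin n → ℕ
  A∖ p x z = 𝟙 (adj G x z ∧ not (does (z ≟ p)))

  -- nbAvoiding d p x counts the non-backtracking walks of length d from x to u whose first step is not to p,
  -- and nb d x all non-backtracking walks of length d from x to u.
  nbAvoiding : ℕ → Fin n → Fin n → ℕ
  nbAvoiding zero    p x = δ x u
  nbAvoiding (suc d) p x = ∑[ z < n ] (A∖ p x z * nbAvoiding d x z)

  nb : ℕ → Fin n → ℕ
  nb zero    x = δ x u
  nb (suc d) x = ∑[ y < n ] (A x y * nbAvoiding d x y)

  A≡A∖+A*δ : ∀ p x z → A x z ≡ A∖ p x z + A x z * δ z p
  A≡A∖+A*δ p x z with adj G x z | does (z ≟ p)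
  ... | false | _     = refl
  ... | true  | false = refl
  ... | true  | true  = refl

  nb-first-step : ∀ d x y → nb (suc d) y ≡ nbAvoiding (suc d) x y + A y x * nbAvoiding d y x
  nb-first-step d x y = begin
    ∑[ z < n ] (A y z * nbAvoiding d y z)
      ≡⟨ sum-cong-≗ (λ z → trans (cong (_* nbAvoiding d y z) (A≡A∖+A*δ x y z))
                                 (*-distribʳ-+ (nbAvoiding d y z) (A∖ x y z) (A y z * δ z x))) ⟩
    ∑[ z < n ] (A∖ x y z * nbAvoiding d y z + A y z * δ z x * nbAvoiding d y z)
      ≡⟨ ∑-distrib-+ (λ z → A∖ x y z * nbAvoiding d y z) (λ z → A y z * δ z x * nbAvoiding d y z) ⟩
    nbAvoiding (suc d) x y + ∑[ z < n ] (A y z * δ z x * nbAvoiding d y z)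
      ≡⟨ cong (nbAvoiding (suc d) x y +_) (trans
           (sum-cong-≗ (λ z → trans (*-assoc (A y z) (δ z x) _) (*-left-comm (A y z) (δ z x) _)))
           (sum-δ x (λ z → A y z * nbAvoiding d y z))) ⟩
    nbAvoiding (suc d) x y + A y x * nbAvoiding d y x ∎
    where open ≡-Reasoning

  sum-A*A∖ : ∀ x z → ∑[ y < n ] (A x y * A∖ y x z) ≡ A x z * (k ∸ 1)
  sum-A*A∖ x z = begin
    ∑[ y < n ] (A x y * A∖ y x z)              ≡⟨ sum-cong-≗ (λ y → trans (cong (A x y *_) (𝟙-∧ (adj G x z) _))
                                                                          (*-left-comm (A x y) (A x z) _)) ⟩
    ∑[ y < n ] (A x z * (A x y * others y))    ≡⟨ *-distribˡ-sum (A x z) (λ y → A x y * others y) ⟨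
    A x z * ∑[ y < n ] (A x y * others y)      ≡⟨ guard (adj G x z) sum-others ⟩
    A x z * (k ∸ 1)                            ∎
    where
    open ≡-Reasoning
    others : Fin n → ℕ
    others y = 𝟙 (not (does (z ≟ y)))
    sum-others : ∑[ y < n ] (A x y * others y) + A x z ≡ k
    sum-others = begin
      ∑[ y < n ] (A x y * others y) + A x z
        ≡⟨ cong (∑[ y < n ] (A x y * others y) +_) (sum-δʳ z (A x)) ⟨
      ∑[ y < n ] (A x y * others y) + ∑[ y < n ] (A x y * δ y z)
        ≡⟨ ∑-distrib-+ (λ y → A x y * others y) (λ y → A x y * δ y z) ⟨
      ∑[ y < n ] (A x y * others y + A x y * δ y z)
        ≡⟨ sum-cong-≗ (λ y → trans (sym (*-distribˡ-+ (A x y) (others y) (δ y z)))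
                                   (trans (cong (λ t → A x y * (others y + t)) (δ-sym y z))
                                          (trans (cong (A x y *_) (𝟙-not+𝟙 (does (z ≟ y)))) (*-identityʳ (A x y))))) ⟩
      sum (A x)
        ≡⟨ sum-A regular x ⟩
      k ∎
    guard : ∀ b {s} → s + 𝟙 b ≡ k → 𝟙 b * s ≡ 𝟙 b * (k ∸ 1)
    guard false     _   = refl
    guard true  {s} s+1≡k = cong (_+ 0) (trans (sym (m+n∸n≡m s 1)) (cong (_∸ 1) s+1≡k))

  -- A step x → y followed by a non-backtracking walk of length d + 1 from y whose first step returns to x is a
  -- non-backtracking walk of length d from x together with the choice of y: any neighbour of x if d = 0, and any
  -- neighbour other than the second vertex of that walk otherwise.
  backtrackChoices : ℕ → ℕ
  backtrackChoices zero    = k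
  backtrackChoices (suc _) = k ∸ 1

  backtracks : ℕ → Fin n → ℕ
  backtracks zero    x = 0
  backtracks (suc d) x = backtrackChoices d * nb d x

  sum-A*nbAvoiding-back : ∀ d x → ∑[ y < n ] (A x y * nbAvoiding d y x) ≡ backtrackChoices d * nb d x
  sum-A*nbAvoiding-back zero    x = trans (sym (*-distribʳ-sum (δ x u) (A x))) (cong (_* δ x u) (sum-A regular x))
  sum-A*nbAvoiding-back (suc d) x = begin
    ∑[ y < n ] (A x y * ∑[ z < n ] (A∖ y x z * nbAvoiding d x z))
      ≡⟨ sum-cong-≗ (λ y → *-distribˡ-sum (A x y) (λ z → A∖ y x z * nbAvoiding d x z)) ⟩
    ∑[ y < n ] ∑[ z < n ] (A x y * (A∖ y x z * nbAvoiding d x z))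
      ≡⟨ ∑-comm (λ y z → A x y * (A∖ y x z * nbAvoiding d x z)) ⟩
    ∑[ z < n ] ∑[ y < n ] (A x y * (A∖ y x z * nbAvoiding d x z))
      ≡⟨ sum-cong-≗ (λ z → trans (sum-cong-≗ (λ y → sym (*-assoc (A x y) (A∖ y x z) _)))
                                 (sym (*-distribʳ-sum (nbAvoiding d x z) (λ y → A x y * A∖ y x z)))) ⟩
    ∑[ z < n ] (∑[ y < n ] (A x y * A∖ y x z) * nbAvoiding d x z)
      ≡⟨ sum-cong-≗ (λ z → trans (cong (_* nbAvoiding d x z) (trans (sum-A*A∖ x z) (*-comm (A x z) (k ∸ 1))))
                                 (*-assoc (k ∸ 1) (A x z) _)) ⟩
    ∑[ z < n ] ((k ∸ 1) * (A x z * nbAvoiding d x z))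
      ≡⟨ *-distribˡ-sum (k ∸ 1) (λ z → A x z * nbAvoiding d x z) ⟨
    (k ∸ 1) * nb (suc d) x ∎
    where open ≡-Reasoning

  sum-A*nb : ∀ d x → ∑[ y < n ] (A x y * nb d y) ≡ nb (suc d) x + backtracks d x
  sum-A*nb zero    x = sym (+-identityʳ _)
  sum-A*nb (suc d) x = begin
    ∑[ y < n ] (A x y * nb (suc d) y)
      ≡⟨ sum-cong-≗ (λ y → trans (cong (A x y *_) (nb-first-step d x y)) (*-distribˡ-+ (A x y) _ _)) ⟩
    ∑[ y < n ] (A x y * nbAvoiding (suc d) x y + A x y * (A y x * nbAvoiding d y x))
      ≡⟨ ∑-distrib-+ (λ y → A x y * nbAvoiding (suc d) x y) (λ y → A x y * (A y x * nbAvoiding d y x)) ⟩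
    nb (suc (suc d)) x + ∑[ y < n ] (A x y * (A y x * nbAvoiding d y x))
      ≡⟨ cong (nb (suc (suc d)) x +_) (sum-cong-≗ (λ y → trans (sym (*-assoc (A x y) (A y x) _))
                                                          (cong (_* nbAvoiding d y x) (A*A-sym y)))) ⟩
    nb (suc (suc d)) x + ∑[ y < n ] (A x y * nbAvoiding d y x)
      ≡⟨ cong (nb (suc (suc d)) x +_) (sum-A*nbAvoiding-back d x) ⟩
    nb (suc (suc d)) x + backtrackChoices d * nb d x ∎
    where
    open ≡-Reasoning
    A*A-sym : ∀ y → A x y * A y x ≡ A x y
    A*A-sym y = trans (cong (A x y *_) (A-sym y x)) (𝟙-idem (adj G x y))

  sum-A*sum-treeWalks*nb : ∀ l B x →
    ∑[ y < n ] (A x y * ∑[ d < B ] (treeWalks k l (toℕ d) * nb (toℕ d) y))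
      ≡ ∑[ d < B ] (treeWalks k l (toℕ d) * nb (suc (toℕ d)) x) + ∑[ d < B ] (treeWalks k l (toℕ d) * backtracks (toℕ d) x)
  sum-A*sum-treeWalks*nb l B x = begin
    ∑[ y < n ] (A x y * ∑[ d < B ] (Tw d * nb (toℕ d) y))
      ≡⟨ sum-cong-≗ {n} (λ y → *-distribˡ-sum {B} (A x y) (λ d → Tw d * nb (toℕ d) y)) ⟩
    ∑[ y < n ] ∑[ d < B ] (A x y * (Tw d * nb (toℕ d) y))
      ≡⟨ ∑-comm {n} {B} (λ y d → A x y * (Tw d * nb (toℕ d) y)) ⟩
    ∑[ d < B ] ∑[ y < n ] (A x y * (Tw d * nb (toℕ d) y))
      ≡⟨ sum-cong-≗ {B} (λ d → trans (sum-cong-≗ {n} (λ y → *-left-comm (A x y) (Tw d) (nb (toℕ d) y)))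
                                     (sym (*-distribˡ-sum {n} (Tw d) (λ y → A x y * nb (toℕ d) y)))) ⟩
    ∑[ d < B ] (Tw d * ∑[ y < n ] (A x y * nb (toℕ d) y))
      ≡⟨ sum-cong-≗ {B} (λ d → trans (cong (Tw d *_) (sum-A*nb (toℕ d) x))
                                     (*-distribˡ-+ (Tw d) (nb (suc (toℕ d)) x) (backtracks (toℕ d) x))) ⟩
    ∑[ d < B ] (Tw d * nb (suc (toℕ d)) x + Tw d * backtracks (toℕ d) x)
      ≡⟨ ∑-distrib-+ {B} (λ d → Tw d * nb (suc (toℕ d)) x) (λ d → Tw d * backtracks (toℕ d) x) ⟩
    ∑[ d < B ] (Tw d * nb (suc (toℕ d)) x) + ∑[ d < B ] (Tw d * backtracks (toℕ d) x) ∎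
    where
    open ≡-Reasoning
    Tw : Fin B → ℕ
    Tw d = treeWalks k l (toℕ d)

  sum-treeWalks*backtracks : ∀ {l B} → l < suc B → ∀ x →
    ∑[ d < suc B ] (treeWalks k l (toℕ d) * backtracks (toℕ d) x)
      ≡ ∑[ d < suc (suc B) ] (backtrackChoices (toℕ d) * treeWalks k l (suc (toℕ d)) * nb (toℕ d) x)
  sum-treeWalks*backtracks {l} {B} l<1+B x = begin
    treeWalks k l 0 * 0 + ∑[ d < B ] (Tw (suc (toℕ d)) * (bc (toℕ d) * nb (toℕ d) x))
      ≡⟨ cong (_+ ∑[ d < B ] (Tw (suc (toℕ d)) * (bc (toℕ d) * nb (toℕ d) x))) (*-zeroʳ (treeWalks k l 0)) ⟩
    ∑[ d < B ] (Tw (suc (toℕ d)) * (bc (toℕ d) * nb (toℕ d) x))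
      ≡⟨ sum-cong-≗ {B} (λ d → trans (*-left-comm (Tw (suc (toℕ d))) (bc (toℕ d)) (nb (toℕ d) x))
                                     (sym (*-assoc (bc (toℕ d)) (Tw (suc (toℕ d))) (nb (toℕ d) x)))) ⟩
    ∑[ d < B ] term (toℕ d)
      ≡⟨ sum-vanishing-tail term (m≤n⇒m≤1+n (n≤1+n B)) vanish ⟨
    ∑[ d < suc (suc B) ] term (toℕ d) ∎
    where
    open ≡-Reasoning
    Tw bc term : ℕ → ℕ
    Tw = treeWalks k l
    bc = backtrackChoices
    term d = bc d * Tw (suc d) * nb d x
    vanish : ∀ d → B ≤ d → term d ≡ 0
    vanish d B≤d = trans (cong (λ t → bc d * t * nb d x) (treeWalks-beyond k (≤-trans l<1+B (s≤s B≤d))))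
                         (cong (_* nb d x) (*-zeroʳ (bc d)))

  -- The recurrence defining treeWalks is the transpose of sum-A*nb.
  walks≡sum-treeWalks*nb : ∀ l {B} → l < B → ∀ x → walks l x u ≡ ∑[ d < B ] (treeWalks k l (toℕ d) * nb (toℕ d) x)
  walks≡sum-treeWalks*nb zero    {suc B}       _         x =
    sym (trans (cong₂ _+_ (*-identityˡ (δ x u)) (sum-replicate-zero B)) (+-identityʳ (δ x u)))
  walks≡sum-treeWalks*nb (suc l) {suc (suc B)} (s≤s l<B) x = begin
    ∑[ y < n ] (A x y * walks l y u)
      ≡⟨ sum-cong-≗ {n} (λ y → cong (A x y *_) (walks≡sum-treeWalks*nb l l<B y)) ⟩
    ∑[ y < n ] (A x y * ∑[ d < suc B ] (Tw (toℕ d) * nb (toℕ d) y))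
      ≡⟨ sum-A*sum-treeWalks*nb l (suc B) x ⟩
    ∑[ d < suc B ] forward (toℕ d) + ∑[ d < suc B ] (Tw (toℕ d) * backtracks (toℕ d) x)
      ≡⟨ cong (∑[ d < suc B ] forward (toℕ d) +_) (sum-treeWalks*backtracks l<B x) ⟩
    ∑[ d < suc B ] forward (toℕ d) + (k * Tw 1 * nb 0 x + ∑[ d < suc B ] backward (toℕ d))
      ≡⟨ +-left-comm (∑[ d < suc B ] forward (toℕ d)) (k * Tw 1 * nb 0 x) (∑[ d < suc B ] backward (toℕ d)) ⟩
    k * Tw 1 * nb 0 x + (∑[ d < suc B ] forward (toℕ d) + ∑[ d < suc B ] backward (toℕ d))
      ≡⟨ cong (k * Tw 1 * nb 0 x +_) (trans (sym (∑-distrib-+ {suc B} (forward ∘ toℕ) (backward ∘ toℕ)))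
           (sum-cong-≗ {suc B} (λ d → sym (*-distribʳ-+ (nb (suc (toℕ d)) x) (Tw (toℕ d)) ((k ∸ 1) * Tw (2 + toℕ d)))))) ⟩
    k * Tw 1 * nb 0 x + ∑[ d < suc B ] ((Tw (toℕ d) + (k ∸ 1) * Tw (2 + toℕ d)) * nb (suc (toℕ d)) x) ∎
    where
    open ≡-Reasoning
    Tw forward backward : ℕ → ℕ
    Tw = treeWalks k l
    forward d = Tw d * nb (suc d) x
    backward d = (k ∸ 1) * Tw (2 + d) * nb (suc d) x

  nbWalkB : ∀ {e} → Fin n → Fin n → Vec (Fin n) e → Bool
  nbWalkB p x []      = adj G x u ∧ not (does (u ≟ p))
  nbWalkB p x (z ∷ w) = (adj G x z ∧ not (does (z ≟ p))) ∧ nbWalkB x z w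

  nbAvoiding≡countB : ∀ e p x → nbAvoiding (suc e) p x ≡ countB (nbWalkB p x) (allVecs e)
  nbAvoiding≡countB zero    p x = trans (sum-δʳ u (A∖ p x)) (sym (+-identityʳ _))
  nbAvoiding≡countB (suc e) p x = begin
    ∑[ z < n ] (A∖ p x z * nbAvoiding (suc e) x z)
      ≡⟨ sum-cong-≗ (λ z → cong (A∖ p x z *_) (nbAvoiding≡countB e x z)) ⟩
    ∑[ z < n ] (A∖ p x z * countB (nbWalkB x z) (allVecs e))
      ≡⟨ sum-cong-≗ (λ z → countB-∧ (adj G x z ∧ not (does (z ≟ p))) (nbWalkB x z) (allVecs e)) ⟨
    ∑[ z < n ] countB (λ w → (adj G x z ∧ not (does (z ≟ p))) ∧ nbWalkB x z w) (allVecs e)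
      ≡⟨ countB-allVecs e (nbWalkB p x) ⟨
    countB (nbWalkB p x) (allVecs (suc e)) ∎
    where open ≡-Reasoning

  nbWalk⇒walk : ∀ {e} p x (w : Vec (Fin n) e) → T (nbWalkB p x w) →
    T (consecAdj G (x ∷ w)) × T (nonBacktracking (p ∷ x ∷ w)) × T (adj G (last (x ∷ w)) u)
  nbWalk⇒walk p x []      nbw = _ , _ , proj₁ (Equivalence.to (T-∧ {adj G x u}) nbw)
  nbWalk⇒walk p x (z ∷ w) nbw with Equivalence.to (T-∧ {adj G x z ∧ not (does (z ≟ p))}) nbw
  ... | step , nbw′ with Equivalence.to (T-∧ {adj G x z}) step | nbWalk⇒walk x z w nbw′
  ...   | xz , z≢p | walk , nbt , closes =
    walk-∷⁺ x z w xz walk , Equivalence.from (T-∧ {not (does (z ≟ p))}) (z≢p , nbt) , closes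

-- Closed walks in a graph of girth g

module Girth {n : ℕ} (G : Graph n) {k g lam : ℕ} (egr : IsEGR G k g lam) (u : Fin n) where
  open IsEGR egr
  open Walks G
  open NonBacktracking G regular u
  open CycleExtraction G

  closedNB⇒cycle : ∀ {e} y (w : Vec (Fin n) e) → (∀ j → j < 2 + e → ¬ HasCycleOfLength G j) →
                   T (adj G u y) → T (nbWalkB u y w) → T (isCycleSeq G (u ∷ y ∷ w))
  closedNB⇒cycle y w noShorter uy nbw with nbWalk⇒walk u y w nbw
  ... | walk , nbt , closes with distinct-or-shorterCycle (u ∷ y ∷ w) (walk-∷⁺ u y w uy walk) nbt
  ...   | inj₁ distinct          = Equivalence.from T-∧ (walk-∷⁺ u y w uy walk , Equivalence.from T-∧ (distinct , closes))
  ...   | inj₂ (j , j<2+e , cyc) = ⊥-elim (noShorter j j<2+e cyc)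

  noClosedNB : ∀ e y (w : Vec (Fin n) e) → 2 + e < g → T (adj G u y) → ¬ T (nbWalkB u y w)
  noClosedNB zero    y []      _     _  nbw =
    T-not⇒¬T (proj₂ (Equivalence.to (T-∧ {adj G y u}) nbw)) (subst T (sym (dec-true (u ≟ u) refl)) _)
  noClosedNB (suc e) y w       2+e<g uy nbw =
    proj₂ girth (3 + e) 2+e<g (s≤s (s≤s (s≤s z≤n)) , u ∷ y ∷ w ,
                               closedNB⇒cycle y w (λ j j< → proj₂ girth j (<-trans j< 2+e<g)) uy nbw)

  nb-short : ∀ d → suc d < g → nb (suc d) u ≡ 0
  nb-short zero    _     = trans (sum-δʳ u (A u)) (cong 𝟙 (adj-irrefl G u))
  nb-short (suc e) 2+e<g = sum-zero (λ y → trans (cong (A u y *_) (nbAvoiding≡countB e u y))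
    (𝟙-guard (adj G u y) (λ uy → countB-none (allVecs e) (λ w → noClosedNB e y w 2+e<g uy))))

  cyclesThroughEdge≡countB : ∀ e y →
    cyclesThroughEdge G (2 + e) u y ≡ countB (λ w → isCycleSeq G (u ∷ y ∷ w)) (allVecs e)
  cyclesThroughEdge≡countB e y = begin
    countB (λ w → startsWith G u y w ∧ isCycleSeq G w) (allVecs (2 + e))
      ≡⟨ countB-allVecs (suc e) (λ w → startsWith G u y w ∧ isCycleSeq G w) ⟩
    ∑[ a < n ] countB (λ w → startsWith G u y (a ∷ w) ∧ isCycleSeq G (a ∷ w)) (allVecs (suc e))
      ≡⟨ sum-cong-≗ (λ a → countB-allVecs e (λ w → startsWith G u y (a ∷ w) ∧ isCycleSeq G (a ∷ w))) ⟩
    ∑[ a < n ] ∑[ b < n ] countB (λ w → (⌊ a ≟ u ⌋ ∧ ⌊ b ≟ y ⌋) ∧ isCycleSeq G (a ∷ b ∷ w)) (allVecs e)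
      ≡⟨ sum-cong-≗ (λ a → sum-cong-≗ (λ b → trans (countB-∧ (⌊ a ≟ u ⌋ ∧ ⌊ b ≟ y ⌋) _ (allVecs e))
                                                   (trans (cong (_* C a b) (starts a b)) (*-assoc (δ a u) (δ b y) (C a b))))) ⟩
    ∑[ a < n ] ∑[ b < n ] (δ a u * (δ b y * C a b))
      ≡⟨ sum-cong-≗ (λ a → *-distribˡ-sum (δ a u) (λ b → δ b y * C a b)) ⟨
    ∑[ a < n ] (δ a u * ∑[ b < n ] (δ b y * C a b))
      ≡⟨ sum-δ u (λ a → ∑[ b < n ] (δ b y * C a b)) ⟩
    ∑[ b < n ] (δ b y * C u b)
      ≡⟨ sum-δ y (C u) ⟩
    C u y ∎
    where
    open ≡-Reasoning
    C : Fin n → Fin n → ℕ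
    C a b = countB (λ w → isCycleSeq G (a ∷ b ∷ w)) (allVecs e)
    starts : ∀ a b → 𝟙 (⌊ a ≟ u ⌋ ∧ ⌊ b ≟ y ⌋) ≡ δ a u * δ b y
    starts a b = trans (𝟙-∧ ⌊ a ≟ u ⌋ ⌊ b ≟ y ⌋)
                       (cong₂ (λ s t → 𝟙 s * 𝟙 t) (isYes≗does (a ≟ u)) (isYes≗does (b ≟ y)))

  nb-girth : ∀ e → 2 + e ≡ g → nb (2 + e) u ≤ k * lam
  nb-girth e 2+e≡g = begin
    ∑[ y < n ] (A u y * nbAvoiding (suc e) u y)
      ≡⟨ sum-cong-≗ (λ y → cong (A u y *_) (nbAvoiding≡countB e u y)) ⟩
    ∑[ y < n ] (A u y * countB (nbWalkB u y) (allVecs e))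
      ≤⟨ sum-mono-≤ (λ y → 𝟙-guard-≤ (adj G u y) (cyclesThrough y)) ⟩
    ∑[ y < n ] (A u y * lam)
      ≡⟨ *-distribʳ-sum lam (A u) ⟨
    sum (A u) * lam
      ≡⟨ cong (_* lam) (sum-A regular u) ⟩
    k * lam ∎
    where
    open ≤-Reasoning
    cyclesThrough : ∀ y → T (adj G u y) → countB (nbWalkB u y) (allVecs e) ≤ lam
    cyclesThrough y uy = begin
      countB (nbWalkB u y) (allVecs e)
        ≤⟨ countB-mono (allVecs e) (λ w → closedNB⇒cycle y w (λ j j< → proj₂ girth j (subst (j <_) 2+e≡g j<)) uy) ⟩
      countB (λ w → isCycleSeq G (u ∷ y ∷ w)) (allVecs e)
        ≡⟨ cyclesThroughEdge≡countB e y ⟨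
      cyclesThroughEdge G (2 + e) u y
        ≡⟨ cong (λ h → cyclesThroughEdge G h u y) 2+e≡g ⟩
      cyclesThroughEdge G g u y
        ≡⟨ edgeCycles u y uy ⟩
      lam ∎

  walks-closed : ∀ l → walks l u u ≡ c l k + ∑[ d < l ] (treeWalks k l (suc (toℕ d)) * nb (suc (toℕ d)) u)
  walks-closed l = trans (walks≡sum-treeWalks*nb l (n<1+n l) u)
    (cong (_+ ∑[ d < l ] (treeWalks k l (suc (toℕ d)) * nb (suc (toℕ d)) u))
          (trans (cong (treeWalks k l 0 *_) (δ-refl u)) (*-identityʳ (c l k))))

  walks-closed-short : ∀ l → l < g → walks l u u ≡ c l k
  walks-closed-short l l<g = trans (walks-closed l) (trans (cong (c l k +_) (sum-zero {l} (λ d →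
    trans (cong (treeWalks k l (suc (toℕ d)) *_) (nb-short (toℕ d) (≤-<-trans (toℕ<n d) l<g)))
          (*-zeroʳ (treeWalks k l (suc (toℕ d))))))) (+-identityʳ (c l k)))

  walks-closed-girth : walks g u u ≤ c g k + k * lam
  walks-closed-girth with proj₁ (proj₁ girth)
  ... | s≤s (s≤s (s≤s {n = g₀} _)) = begin
    walks g u u
      ≡⟨ walks-closed g ⟩
    c g k + ∑[ d < g ] (treeWalks k g (suc (toℕ d)) * nb (suc (toℕ d)) u)
      ≡⟨ cong (c g k +_) (sum-only-last (λ d → treeWalks k g (suc d) * nb (suc d) u)
           (λ d d<2+g₀ → trans (cong (treeWalks k g (suc d) *_) (nb-short d (s≤s d<2+g₀)))
                               (*-zeroʳ (treeWalks k g (suc d))))) ⟩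
    c g k + treeWalks k g g * nb g u
      ≡⟨ cong (λ t → c g k + t * nb g u) (treeWalks-diag k g) ⟩
    c g k + 1 * nb g u
      ≤⟨ +-monoʳ-≤ (c g k) (≤-trans (≤-reflexive (*-identityˡ (nb g u))) (nb-girth (suc g₀) refl)) ⟩
    c g k + k * lam ∎
    where open ≤-Reasoning

count : ∀ {n} → (Fin n → Bool) → ℕ
count {n} P = ∑[ v < n ] 𝟙 (P v)

except : ∀ {n} → Fin n → (Fin n → Bool) → Fin n → Bool
except x P v = not (does (v ≟ x)) ∧ P v

except-self : ∀ {n} (x : Fin n) (P : Fin n → Bool) → except x P x ≡ false
except-self x P = cong (λ b → not b ∧ P x) (dec-true (x ≟ x) refl)

count-except : ∀ {n} (x : Fin n) (P : Fin n → Bool) → T (P x) → suc (count (except x P)) ≡ count P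
count-except {n} x P Px = begin
  suc (count (except x P))                    ≡⟨ +-comm 1 _ ⟩
  count (except x P) + 1                      ≡⟨ cong (count (except x P) +_) (sum-δ x (λ _ → 1)) ⟨
  count (except x P) + ∑[ v < n ] (δ v x * 1) ≡⟨ ∑-distrib-+ (λ v → 𝟙 (except x P v)) (λ v → δ v x * 1) ⟨
  ∑[ v < n ] (𝟙 (except x P v) + δ v x * 1)            ≡⟨ sum-cong-≗ pointwise ⟩
  count P                                              ∎
  where
  open ≡-Reasoning
  pointwise : ∀ v → 𝟙 (except x P v) + δ v x * 1 ≡ 𝟙 (P v)
  pointwise v with v ≟ x
  ... | yes refl = cong 𝟙 (sym (Equivalence.to T-≡ Px))
  ... | no  _    = +-identityʳ (𝟙 (P v))

count-complement : ∀ {n} (P Q : Fin n → Bool) → (∀ v → P v ≡ not (Q v)) → count P + count Q ≡ n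
count-complement {n} P Q P≡¬Q = begin
  count P + count Q                       ≡⟨ ∑-distrib-+ (λ v → 𝟙 (P v)) (λ v → 𝟙 (Q v)) ⟨
  ∑[ v < n ] (𝟙 (P v) + 𝟙 (Q v))          ≡⟨ sum-cong-≗ (λ v → trans (cong (λ b → 𝟙 b + 𝟙 (Q v)) (P≡¬Q v))
                                                                     (𝟙-not+𝟙 (Q v))) ⟩
  ∑[ v < n ] 1                            ≡⟨ sum-ones n ⟩
  n                                       ∎
  where open ≡-Reasoning

sameColour : ∀ {n} → (Fin n → Bool) → Fin n → Fin n → Bool
sameColour col x v = does (col v Bool.≟ col x)

sameColour-flip : ∀ {n} (col : Fin n → Bool) {u w} → col u ≢ col w →
                  ∀ v → sameColour col w v ≡ not (sameColour col u v)
sameColour-flip col {u} {w} u≢w v rewrite ¬-not (u≢w ∘ sym) = flip (col v) (col u)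
  where
  flip : ∀ a b → does (a Bool.≟ not b) ≡ not (does (a Bool.≟ b))
  flip true  true  = refl
  flip true  false = refl
  flip false true  = refl
  flip false false = refl

-- Halving the girth

half-sum : ∀ {g} → 2 ∣ g → g / 2 + g / 2 ≡ g
half-sum {g} 2∣g = trans (sym (*-two (g / 2))) (m/n*n≡m 2∣g)
  where
  *-two : ∀ m → m * 2 ≡ m + m
  *-two = solve-∀

[m+m]%4 : ∀ m → (m + m) % 4 ≡ (if odd m then 2 else 0)
[m+m]%4 zero          = refl
[m+m]%4 (suc zero)    = refl
[m+m]%4 (suc (suc m)) = begin
  (2 + m + (2 + m)) % 4     ≡⟨ cong (_% 4) (shift m) ⟩
  (m + m + 1 * 4) % 4       ≡⟨ [m+kn]%n≡m%n (m + m) 1 4 ⟩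
  (m + m) % 4               ≡⟨ [m+m]%4 m ⟩
  (if odd m then 2 else 0)  ≡⟨ cong (λ b → if b then 2 else 0) (not-involutive (odd m)) ⟨
  (if odd (2 + m) then 2 else 0) ∎
  where
  open ≡-Reasoning
  shift : ∀ m → 2 + m + (2 + m) ≡ m + m + 1 * 4
  shift = solve-∀

even-half : ∀ {m g} → m + m ≡ g → g % 4 ≡ 0 → odd m ≡ false
even-half {m} refl g%4≡0 with odd m | [m+m]%4 m
... | false | _          = refl
... | true  | g%4≡2      = case trans (sym g%4≡2) g%4≡0 of λ ()

odd-half : ∀ {m g} → m + m ≡ g → g % 4 ≡ 2 → odd m ≡ true
odd-half {m} refl g%4≡2 with odd m | [m+m]%4 m
... | true  | _          = refl
... | false | g%4≡0      = case trans (sym g%4≡0) g%4≡2 of λ ()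

half<whole : ∀ {m g} → 3 ≤ g → m + m ≡ g → m < g
half<whole {zero}  3≤g refl = case 3≤g of λ ()
half<whole {suc m} _   refl = m<m+n (suc m) z<s

-- Imported only here: ℤ's prefix +_ makes the sections (a +_) used above ambiguous.
open import Data.Integer using (ℤ; +_; +≤+; -_)
  renaming (_+_ to _+ᶻ_; _-_ to _-ᶻ_; _*_ to _*ᶻ_; _≤_ to _≤ᶻ_)
import Data.Integer.Properties as ℤ
import Data.Integer.Tactic.RingSolver as ℤ-Ring
open import Data.Nat using () renaming (_*_ to _*ℕ_)

moments⇒square-bound : ∀ {K C} Σ₁ Σ₂ M Cg L → C + Σ₁ ≡ K → C * C + Σ₂ ≤ Cg + L → Σ₁ * Σ₁ ≤ M * Σ₂ →
                       (+ K -ᶻ + C) *ᶻ (+ K -ᶻ + C) ≤ᶻ + M *ᶻ (+ Cg +ᶻ + L -ᶻ + C *ᶻ + C)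
moments⇒square-bound {K} {C} Σ₁ Σ₂ M Cg L C+Σ₁≡K CC+Σ₂≤ Σ₁Σ₁≤MΣ₂ = begin
  (+ K -ᶻ + C) *ᶻ (+ K -ᶻ + C)       ≡⟨ cong (λ t → t *ᶻ t) K-C≡Σ₁ ⟩
  + Σ₁ *ᶻ + Σ₁                       ≡⟨ ℤ.pos-* Σ₁ Σ₁ ⟨
  + (Σ₁ * Σ₁)                        ≤⟨ +≤+ Σ₁Σ₁≤MΣ₂ ⟩
  + (M * Σ₂)                         ≡⟨ ℤ.pos-* M Σ₂ ⟩
  + M *ᶻ + Σ₂                        ≤⟨ ℤ.*-monoˡ-≤-nonNeg (+ M) Σ₂≤X ⟩
  + M *ᶻ (+ Cg +ᶻ + L -ᶻ + C *ᶻ + C) ∎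
  where
  open ℤ.≤-Reasoning
  cancel : ∀ a b → a +ᶻ b -ᶻ a ≡ b
  cancel = ℤ-Ring.solve-∀
  K-C≡Σ₁ : + K -ᶻ + C ≡ + Σ₁
  K-C≡Σ₁ = trans (cong (λ t → + t -ᶻ + C) (sym C+Σ₁≡K)) (trans (cong (_-ᶻ + C) (ℤ.pos-+ C Σ₁)) (cancel (+ C) (+ Σ₁)))
  CC+Σ₂≤ᶻ : + C *ᶻ + C +ᶻ + Σ₂ ≤ᶻ + Cg +ᶻ + L
  CC+Σ₂≤ᶻ = subst₂ _≤ᶻ_ (trans (ℤ.pos-+ (C * C) Σ₂) (cong (_+ᶻ + Σ₂) (ℤ.pos-* C C))) (ℤ.pos-+ Cg L) (+≤+ CC+Σ₂≤)
  Σ₂≤X : + Σ₂ ≤ᶻ + Cg +ᶻ + L -ᶻ + C *ᶻ + C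
  Σ₂≤X = subst (_≤ᶻ + Cg +ᶻ + L -ᶻ + C *ᶻ + C) (cancel (+ C *ᶻ + C) (+ Σ₂)) (ℤ.+-monoˡ-≤ (- (+ C *ᶻ + C)) CC+Σ₂≤ᶻ)

module VertexEstimate {n : ℕ} (G : Graph n) {k g lam : ℕ} (egr : IsEGR G k g lam) {m : ℕ} (m+m≡g : m + m ≡ g)
                      (x : Fin n) where
  open IsEGR egr
  open Walks G
  open Girth G egr x

  m<g : m < g
  m<g = half<whole (proj₁ (proj₁ girth)) m+m≡g

  square-bound : ∀ S → Supported m x S →
    (+ (k ^ m) -ᶻ + c m k) *ᶻ (+ (k ^ m) -ᶻ + c m k) ≤ᶻ + count S *ᶻ (+ c g k +ᶻ + (k * lam) -ᶻ + c m k *ᶻ + c m k)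
  square-bound S (Sx≡false , support) =
    moments⇒square-bound Σ₁ Σ₂ (count S) (c g k) (k * lam) first-moment second-moment (cauchy-schwarz (𝟙 ∘ S) W)
    where
    W : Fin n → ℕ
    W = walks m x
    Σ₁ Σ₂ : ℕ
    Σ₁ = ∑[ v < n ] (𝟙 (S v) * W v)
    Σ₂ = ∑[ v < n ] (𝟙 (S v) * (W v * W v))
    first-moment : c m k + Σ₁ ≡ k ^ m
    first-moment = begin
      c m k + Σ₁       ≡⟨ cong (_+ Σ₁) (walks-closed-short m m<g) ⟨
      W x + Σ₁         ≡⟨ sum-split-support S W x Sx≡false support ⟩
      ∑[ v < n ] W v   ≡⟨ sum-walks regular m x ⟩
      k ^ m            ∎
      where open ≡-Reasoning
    second-moment : c m k * c m k + Σ₂ ≤ c g k + k * lam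
    second-moment = begin
      c m k * c m k + Σ₂
        ≡⟨ cong (λ t → t * t + Σ₂) (walks-closed-short m m<g) ⟨
      W x * W x + Σ₂
        ≡⟨ sum-split-support S (λ v → W v * W v) x Sx≡false (λ v v≢x ¬Sv → cong (λ t → t * t) (support v v≢x ¬Sv)) ⟩
      ∑[ v < n ] (W v * W v)
        ≡⟨ sum-walks² m x ⟩
      walks (m + m) x x
        ≡⟨ cong (λ l → walks l x x) m+m≡g ⟩
      walks g x x
        ≤⟨ walks-closed-girth ⟩
      c g k + k * lam ∎
      where open ≤-Reasoning

square-bound⇒order-bound : ∀ Cg L C K M → (+ K -ᶻ + C) *ᶻ (+ K -ᶻ + C) ≤ᶻ + M *ᶻ (+ Cg +ᶻ + L -ᶻ + C *ᶻ + C) →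
  + Cg +ᶻ + L +ᶻ + (K * K) -ᶻ + 2 *ᶻ + C *ᶻ + K ≤ᶻ + suc M *ᶻ (+ Cg -ᶻ + C *ᶻ + C +ᶻ + L)
square-bound⇒order-bound Cg L C K M square≤ = begin
  + Cg +ᶻ + L +ᶻ + (K * K) -ᶻ + 2 *ᶻ + C *ᶻ + K  ≡⟨ cong (λ t → + Cg +ᶻ + L +ᶻ t -ᶻ + 2 *ᶻ + C *ᶻ + K) (ℤ.pos-* K K) ⟩
  + Cg +ᶻ + L +ᶻ + K *ᶻ + K -ᶻ + 2 *ᶻ + C *ᶻ + K ≡⟨ expand (+ Cg) (+ L) (+ C) (+ K) ⟩
  X +ᶻ (+ K -ᶻ + C) *ᶻ (+ K -ᶻ + C)               ≤⟨ ℤ.+-monoʳ-≤ X square≤ ⟩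
  X +ᶻ + M *ᶻ X                                   ≡⟨ collect (+ Cg) (+ L) (+ C) (+ M) ⟩
  (+ 1 +ᶻ + M) *ᶻ (+ Cg -ᶻ + C *ᶻ + C +ᶻ + L)     ≡⟨ cong (_*ᶻ (+ Cg -ᶻ + C *ᶻ + C +ᶻ + L)) (ℤ.pos-+ 1 M) ⟨
  + suc M *ᶻ (+ Cg -ᶻ + C *ᶻ + C +ᶻ + L)          ∎
  where
  open ℤ.≤-Reasoning
  X : ℤ
  X = + Cg +ᶻ + L -ᶻ + C *ᶻ + C
  expand : ∀ cg l c κ → cg +ᶻ l +ᶻ κ *ᶻ κ -ᶻ + 2 *ᶻ c *ᶻ κ ≡ cg +ᶻ l -ᶻ c *ᶻ c +ᶻ (κ -ᶻ c) *ᶻ (κ -ᶻ c)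
  expand = ℤ-Ring.solve-∀
  collect : ∀ cg l c μ → cg +ᶻ l -ᶻ c *ᶻ c +ᶻ μ *ᶻ (cg +ᶻ l -ᶻ c *ᶻ c) ≡ (+ 1 +ᶻ μ) *ᶻ (cg -ᶻ c *ᶻ c +ᶻ l)
  collect = ℤ-Ring.solve-∀

double-bound : ∀ {a x : ℤ} p q → a ≤ᶻ + p *ᶻ x → a ≤ᶻ + q *ᶻ x → + 2 *ᶻ a ≤ᶻ + (p + q) *ᶻ x
double-bound {a} {x} p q a≤px a≤qx = begin
  + 2 *ᶻ a             ≡⟨ twice a ⟩
  a +ᶻ a               ≤⟨ ℤ.+-mono-≤ a≤px a≤qx ⟩
  + p *ᶻ x +ᶻ + q *ᶻ x ≡⟨ ℤ.*-distribʳ-+ x (+ p) (+ q) ⟨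
  (+ p +ᶻ + q) *ᶻ x    ≡⟨ cong (_*ᶻ x) (ℤ.pos-+ p q) ⟨
  + (p + q) *ᶻ x       ∎
  where
  open ℤ.≤-Reasoning
  twice : ∀ a → + 2 *ᶻ a ≡ a +ᶻ a
  twice = ℤ-Ring.solve-∀

module Bounds {n : ℕ} (H : Graph n) {k g lam : ℕ} (egr : IsEGR H k g lam) {m : ℕ} (m+m≡g : m + m ≡ g) where
  open IsEGR egr
  open Walks H
  open VertexEstimate H egr {m} m+m≡g using (square-bound)

  k^m*k^m≡k^g : k ^ m * k ^ m ≡ k ^ g
  k^m*k^m≡k^g = trans (sym (^-distribˡ-+-* k m m)) (cong (k ^_) m+m≡g)

  order-bound : ∀ x S → Supported m x S →
    + c g k +ᶻ + (k * lam) +ᶻ + (k ^ g) -ᶻ + 2 *ᶻ + c m k *ᶻ + (k ^ m)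
      ≤ᶻ + suc (count S) *ᶻ (+ c g k -ᶻ + c m k *ᶻ + c m k +ᶻ + (k * lam))
  order-bound x S supported =
    subst (λ K → + c g k +ᶻ + (k * lam) +ᶻ + K -ᶻ + 2 *ᶻ + c m k *ᶻ + (k ^ m)
                   ≤ᶻ + suc (count S) *ᶻ (+ c g k -ᶻ + c m k *ᶻ + c m k +ᶻ + (k * lam)))
          k^m*k^m≡k^g (square-bound⇒order-bound (c g k) (k * lam) (c m k) (k ^ m) (count S) (square-bound x S supported))

  edge : ∃[ u ] ∃[ w ] T (adj H u w)
  edge = cycle⇒edge H (proj₁ girth)

  egr-bound : + c g k +ᶻ + (k * lam) +ᶻ + (k ^ g) -ᶻ + 2 *ᶻ + c m k *ᶻ + (k ^ m)
                ≤ᶻ + n *ᶻ (+ c g k -ᶻ + c m k *ᶻ + c m k +ᶻ + (k * lam))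
  egr-bound with edge
  ... | u , _ = subst (λ N → _ ≤ᶻ + N *ᶻ (+ c g k -ᶻ + c m k *ᶻ + c m k +ᶻ + (k * lam)))
                      (trans (count-except u all _) (sum-ones n))
                      (order-bound u (except u all) (except-self u all , support))
    where
    all : Fin n → Bool
    all _ = true
    support : ∀ v → v ≢ u → ¬ T (except u all v) → walks m u v ≡ 0
    support v v≢u ¬Sv = ⊥-elim (¬Sv (subst T (sym (cong (λ b → not b ∧ true) (dec-false (v ≟ u) v≢u))) _))

  egr-bound-odd : odd m ≡ true → + c g k +ᶻ + (k * lam) +ᶻ + (k ^ g) ≤ᶻ + n *ᶻ (+ c g k +ᶻ + (k * lam))
  egr-bound-odd odd-m = subst₂ _≤ᶻ_
    (trans (cong (λ t → + c g k +ᶻ + (k * lam) +ᶻ + (k ^ g) -ᶻ + 2 *ᶻ + t *ᶻ + (k ^ m)) (c-odd k m odd-m))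
           (drop (+ c g k +ᶻ + (k * lam) +ᶻ + (k ^ g)) (+ (k ^ m))))
    (cong (+ n *ᶻ_) (trans (cong (λ t → + c g k -ᶻ + t *ᶻ + t +ᶻ + (k * lam)) (c-odd k m odd-m))
                           (drop² (+ c g k) (+ (k * lam)))))
    egr-bound
    where
    drop : ∀ a b → a -ᶻ + 2 *ᶻ + 0 *ᶻ b ≡ a
    drop = ℤ-Ring.solve-∀
    drop² : ∀ a b → a -ᶻ + 0 *ᶻ + 0 +ᶻ b ≡ a +ᶻ b
    drop² = ℤ-Ring.solve-∀

  module _ (bipartite : IsBipartite H) where

    col : Fin n → Bool
    col = proj₁ bipartite

    proper : ∀ x y → T (adj H x y) → col x ≢ col y
    proper = proj₂ bipartite

    sameColour⁺ : ∀ {x v} → col v ≡ col x → T (sameColour col x v)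
    sameColour⁺ {x} {v} v≡x = subst T (sym (dec-true (col v Bool.≟ col x) v≡x)) _

    sameColour⁻ : ∀ {x v} → T (sameColour col x v) → col v ≡ col x
    sameColour⁻ {x} {v} _ with col v Bool.≟ col x
    ... | yes v≡x = v≡x

    walks-colour : ∀ x v → col v ≢ odd m xor col x → walks m x v ≡ 0
    walks-colour = walks-bipartite col proper m

    colourClass otherClass : Fin n → Fin n → Bool
    colourClass x = except x (sameColour col x)
    otherClass x = not ∘ sameColour col x

    colourClass-supported : odd m ≡ false → ∀ x → Supported m x (colourClass x)
    colourClass-supported even-m x = except-self x (sameColour col x) , λ v v≢x ¬Sv → walks-colour x v (λ v≡ →
      ¬Sv (subst T (sym (cong (λ b → not b ∧ sameColour col x v) (dec-false (v ≟ x) v≢x)))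
                   (sameColour⁺ (trans v≡ (cong (_xor col x) even-m)))))

    otherClass-supported : odd m ≡ true → ∀ x → Supported m x (otherClass x)
    otherClass-supported odd-m x = cong not (dec-true (col x Bool.≟ col x) refl) , λ v _ ¬Sv → walks-colour x v (λ v≡ →
      Bool.not-¬ refl (trans (sym (sameColour⁻ (¬T-not⇒T ¬Sv))) (trans v≡ (cong (_xor col x) odd-m))))

    bipartite-bound-even : odd m ≡ false →
      + 2 *ᶻ (+ c g k +ᶻ + (k * lam) +ᶻ + (k ^ g) -ᶻ + 2 *ᶻ + c m k *ᶻ + (k ^ m))
        ≤ᶻ + n *ᶻ (+ c g k -ᶻ + c m k *ᶻ + c m k +ᶻ + (k * lam))
    bipartite-bound-even even-m with edge
    ... | u , w , uw = subst (λ N → _ ≤ᶻ + N *ᶻ (+ c g k -ᶻ + c m k *ᶻ + c m k +ᶻ + (k * lam)))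
      (trans (cong₂ _+_ (count-except u (sameColour col u) (sameColour⁺ refl))
                        (count-except w (sameColour col w) (sameColour⁺ refl)))
             (count-complement (sameColour col u) (sameColour col w) (sameColour-flip col (proper u w uw ∘ sym))))
      (double-bound (suc (count (colourClass u))) (suc (count (colourClass w)))
                    (order-bound u _ (colourClass-supported even-m u)) (order-bound w _ (colourClass-supported even-m w)))

    bipartite-bound-odd : odd m ≡ true → + 2 *ᶻ + (k ^ g) ≤ᶻ + n *ᶻ (+ c g k +ᶻ + (k * lam))
    bipartite-bound-odd odd-m with edge
    ... | u , w , uw = subst₂ _≤ᶻ_
      (cong (+ 2 *ᶻ_) (trans (cong (λ t → (+ (k ^ m) -ᶻ + t) *ᶻ (+ (k ^ m) -ᶻ + t)) (c-odd k m odd-m))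
                             (trans (square (+ (k ^ m))) (trans (sym (ℤ.pos-* (k ^ m) (k ^ m))) (cong +_ k^m*k^m≡k^g)))))
      (cong₂ _*ᶻ_ (cong +_ (count-complement (otherClass u) (otherClass w) complement))
                  (trans (cong (λ t → + c g k +ᶻ + (k * lam) -ᶻ + t *ᶻ + t) (c-odd k m odd-m)) (drop (+ c g k +ᶻ + (k * lam)))))
      (double-bound (count (otherClass u)) (count (otherClass w))
                    (square-bound u _ (otherClass-supported odd-m u)) (square-bound w _ (otherClass-supported odd-m w)))
      where
      square : ∀ a → (a -ᶻ + 0) *ᶻ (a -ᶻ + 0) ≡ a *ᶻ a
      square = ℤ-Ring.solve-∀
      drop : ∀ a → a -ᶻ + 0 *ᶻ + 0 ≡ a
      drop = ℤ-Ring.solve-∀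
      complement : ∀ v → not (sameColour col u v) ≡ not (not (sameColour col w v))
      complement v = cong not (trans (sym (not-involutive _)) (cong not (sym (sameColour-flip col (proper u w uw) v))))

mainTheorem11 :
  ∀ (k g lam : ℕ) → 3 ≤ k → 2 ∣ g →
  ∀ {n₀ : ℕ} (G : Graph n₀) → IsEGR G k g lam →
  (g % 4 ≡ 0 →
    (∀ (n : ℕ) (H : Graph n) → IsEGR H k g lam →
      (+ c g k +ᶻ + (k *ℕ lam) +ᶻ + (k ^ g) -ᶻ + 2 *ᶻ + c (g / 2) k *ᶻ + (k ^ (g / 2)))
        ≤ᶻ + n *ᶻ (+ c g k -ᶻ + c (g / 2) k *ᶻ + c (g / 2) k +ᶻ + (k *ℕ lam)))
    ×
    (∀ (n : ℕ) (H : Graph n) → IsEGR H k g lam → IsBipartite H →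
      + 2 *ᶻ (+ c g k +ᶻ + (k *ℕ lam) +ᶻ + (k ^ g) -ᶻ + 2 *ᶻ + c (g / 2) k *ᶻ + (k ^ (g / 2)))
        ≤ᶻ + n *ᶻ (+ c g k -ᶻ + c (g / 2) k *ᶻ + c (g / 2) k +ᶻ + (k *ℕ lam))))
  ×
  (g % 4 ≡ 2 →
    (∀ (n : ℕ) (H : Graph n) → IsEGR H k g lam →
      (+ c g k +ᶻ + (k *ℕ lam) +ᶻ + (k ^ g))
        ≤ᶻ + n *ᶻ (+ c g k +ᶻ + (k *ℕ lam)))
    ×
    (∀ (n : ℕ) (H : Graph n) → IsEGR H k g lam → IsBipartite H →
      + 2 *ᶻ + (k ^ g)
        ≤ᶻ + n *ᶻ (+ c g k +ᶻ + (k *ℕ lam))))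
mainTheorem11 k g lam _ 2∣g _ _ =
    (λ g%4≡0 → (λ _ H egr → Bounds.egr-bound H egr {m} half)
             , (λ _ H egr bip → Bounds.bipartite-bound-even H egr {m} half bip (even-half {m} half g%4≡0)))
  , (λ g%4≡2 → (λ _ H egr → Bounds.egr-bound-odd H egr {m} half (odd-half {m} half g%4≡2))
             , (λ _ H egr bip → Bounds.bipartite-bound-odd H egr {m} half bip (odd-half {m} half g%4≡2)))
  where
  m : ℕ
  m = g / 2
  half : m + m ≡ g
  half = half-sum 2∣g
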